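{- Let $G=(V,E)$ be a graph and let $E_M=\{e_1,\dots,e_d\}$ be a matching of new edges (each $e_i$ joins two vertices of $V$, $e_i\notin E$, and no two edges of $E_M$ share an endpoint). Let $G'=(V,E\cup E_M)$. Then for every vertex $w\in V$, $core_{G'}(w)\le core_G(w)+1$, i.e. the core number of every vertex increases by at most $1$.
   Context: All graphs are finite, simple and undirected. For an integer $k$, a $k$-core of a graph $G$ is a connected subgraph $H$ of $G$ in which every vertex has at least $k$ neighbours in $H$. The core number $core_G(u)$ of a vertex $u$ is the largest $k$ such that some $k$-core of $G$ contains $u$. A matching is a set of edges no two of which share an endpoint. -}

module Defs where

open import Data.Nat using (ℕ; _≤_; _+_)
open import Data.Fin using (Fin)
open import Data.Bool using (Bool; true; false; T; _∨_)
open import Data.List using (List; length; filter; allFin)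
open import Data.Product using (Σ; _×_; ∃)
open import Relation.Binary.PropositionalEquality using (_≡_)
open import Data.Bool.Properties using (T?)

record Graph (n : ℕ) : Set where
  field
    adj   : Fin n → Fin n → Bool
    sym   : ∀ u v → adj u v ≡ adj v u
    irrefl : ∀ u → adj u u ≡ false
open Graph public

record Subgraph {n : ℕ} (G : Graph n) : Set where
  field
    vs    : Fin n → Bool
    es    : Fin n → Fin n → Bool
    esSym : ∀ u v → es u v ≡ es v u
    esAdj : ∀ u v → T (es u v) → T (adj G u v)
    esVs  : ∀ u v → T (es u v) → T (vs u) × T (vs v)
open Subgraph public

data Walk {n : ℕ} {G : Graph n} (H : Subgraph G) : Fin n → Fin n → Set where
  here : ∀ {u} → T (vs H u) → Walk H u u
  step : ∀ {u v w} → T (es H u v) → Walk H v w → Walk H u w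

Connected : ∀ {n} {G : Graph n} → Subgraph G → Set
Connected H = ∀ u v → T (vs H u) → T (vs H v) → Walk H u v

degIn : ∀ {n} {G : Graph n} → Subgraph G → Fin n → ℕ
degIn {n} H u = length (filter (λ v → T? (es H u v)) (allFin n))

IsCore : ∀ {n} (G : Graph n) → ℕ → Subgraph G → Set
IsCore G k H = Connected H × (∀ u → T (vs H u) → k ≤ degIn H u)

InCore : ∀ {n} (G : Graph n) → ℕ → Fin n → Set
InCore G k u = Σ (Subgraph G) λ H → IsCore G k H × T (vs H u)

IsCoreNumber : ∀ {n} (G : Graph n) → Fin n → ℕ → Set
IsCoreNumber G u c = InCore G c u × (∀ k → InCore G k u → k ≤ c)

record NewMatching {n : ℕ} (G : Graph n) : Set where
  field
    m      : Fin n → Fin n → Bool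
    mSym   : ∀ u v → m u v ≡ m v u
    mIrr   : ∀ u → m u u ≡ false
    mNew   : ∀ u v → T (m u v) → adj G u v ≡ false
    mMatch : ∀ u v w → T (m u v) → T (m u w) → v ≡ w
open NewMatching public

addEdges : ∀ {n} (G : Graph n) → NewMatching G → Graph n
addEdges G M = record
  { adj = λ u v → adj G u v ∨ m M u v
  ; sym = λ u v → cong₂' (sym G u v) (mSym M u v)
  ; irrefl = λ u → irr (irrefl G u) (mIrr M u)
  }
  where
  open import Relation.Binary.PropositionalEquality using (cong₂; refl)
  cong₂' : ∀ {a b c d} → a ≡ b → c ≡ d → (a ∨ c) ≡ (b ∨ d)
  cong₂' p q = cong₂ _∨_ p q
  irr : ∀ {a b} → a ≡ false → b ≡ false → (a ∨ b) ≡ false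
  irr refl refl = refl

module Submission where

-- Let H' be a c'-core of G' = G + M containing w. Deleting the matching
-- edges from H' gives a subgraph H of G on the same vertices in which each
-- degree drops by at most one, since every vertex meets at most one matching
-- edge. H need not be connected, so we pass to the connected component K of
-- w in H. A component keeps every H-edge at its vertices, so K is a
-- (c' ∸ 1)-core of G containing w, and maximality of c gives c' ∸ 1 ≤ c.

open import Defs
open import Data.Nat using (ℕ; zero; suc; _≤_; _<_; _+_; _∸_; z≤n; s≤s)
open import Data.Nat.Properties
  using (≤-trans; ≤-reflexive; m≤n⇒m≤1+n; n≤1+n; 1+n≰n; +-suc; +-comm; +-monoˡ-≤; +-monoʳ-≤;
         m≤n+o⇒m∸n≤o; m≤n+m∸n; module ≤-Reasoning)
open import Data.Fin using (Fin; _≟_)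
open import Data.Fin.Properties using (any?)
open import Data.Bool using (Bool; true; false; T; _∨_; _∧_)
open import Data.Bool.Properties using (T?; T-∨; T-∧; ∧-comm)
open import Data.List using (List; []; _∷_; length; filter; allFin)
open import Data.Bool.ListAction using (any)
open import Data.List.Properties using (length-filter; length-tabulate)
open import Data.List.Membership.Propositional using (_∈_; lose)
open import Data.List.Membership.Propositional.Properties using (∈-allFin)
open import Data.List.Relation.Unary.Any using (here; there; satisfied)
import Data.List.Relation.Unary.Any as Any
open import Data.List.Relation.Unary.Any.Properties using (any⁺; any⁻)
open import Data.List.Relation.Unary.All using (All; _∷_)
open import Data.List.Relation.Unary.All.Properties using (all-filter)
open import Data.List.Relation.Unary.AllPairs using ([]; _∷_)
open import Data.List.Relation.Unary.Unique.Propositional using (Unique)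
import Data.List.Relation.Unary.Unique.Propositional.Properties as Unique
open import Data.List.Relation.Binary.Sublist.Propositional using (⊆-refl)
import Data.List.Relation.Binary.Sublist.Propositional.Properties as Sublist
open import Data.Product using (_,_; proj₁; proj₂; map₂)
open import Data.Sum using (_⊎_; inj₁; inj₂)
open import Data.Unit using (tt)
open import Function using (_∘_; Equivalence)
open import Relation.Nullary using (¬_; yes; no; contradiction)
open import Relation.Nullary.Decidable using (⌊_⌋; toWitness; fromWitness; ¬?; _×-dec_; decidable-stable)
open import Relation.Binary.PropositionalEquality using (_≡_; refl; subst; cong₂) renaming (sym to ≡-sym)

open Equivalence using (to; from)

-- Counting the elements of a list that satisfy a Boolean predicate.
-- By definition, degIn H u is count (es H u) (allFin n).

count : {A : Set} → (A → Bool) → List A → ℕ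
count p xs = length (filter (T? ∘ p) xs)

count-mono : {A : Set} {p q : A → Bool} → (∀ x → T (p x) → T (q x)) →
             ∀ xs → count p xs ≤ count q xs
count-mono {p = p} {q} p⇒q xs =
  Sublist.length-mono-≤ (Sublist.filter⁺ (T? ∘ p) (T? ∘ q) {as = xs} {bs = xs} (λ { refl → p⇒q _ }) ⊆-refl)

count-strict : {A : Set} {p q : A → Bool} {x : A} → (∀ y → T (p y) → T (q y)) →
               ∀ {xs} → x ∈ xs → ¬ T (p x) → T (q x) → count p xs < count q xs
count-strict {p = p} {q} p⇒q {x ∷ xs} (here refl) ¬px qx with p x | q x
... | true  | _     = contradiction tt ¬px
... | false | true  = s≤s (count-mono p⇒q xs)
count-strict {p = p} {q} p⇒q {y ∷ xs} (there x∈xs) ¬px qx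
  with ih ← count-strict p⇒q x∈xs ¬px qx | p y | q y | p⇒q y
... | true  | true  | _        = s≤s ih
... | true  | false | p⇒q-at-y = contradiction (p⇒q-at-y tt) (λ ())
... | false | true  | _        = m≤n⇒m≤1+n ih
... | false | false | _        = ih

count-∨ : {A : Set} (p q : A → Bool) → ∀ xs →
          count (λ x → p x ∨ q x) xs ≤ count p xs + count q xs
count-∨ p q [] = z≤n
count-∨ p q (x ∷ xs) with ih ← count-∨ p q xs | p x | q x
... | true  | true  = s≤s (≤-trans ih (+-monoʳ-≤ (count p xs) (n≤1+n (count q xs))))
... | true  | false = s≤s ih
... | false | true  = ≤-trans (s≤s ih) (≤-reflexive (≡-sym (+-suc (count p xs) (count q xs))))
... | false | false = ih

count-atMostOne : {A : Set} (p : A → Bool) → ∀ {xs} → Unique xs →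
                  (∀ x y → T (p x) → T (p y) → x ≡ y) → count p xs ≤ 1
count-atMostOne p {xs} unique solutionUnique =
  atMostOne (Unique.filter⁺ (T? ∘ p) unique) (all-filter (T? ∘ p) xs)
  where
  atMostOne : ∀ {ys} → Unique ys → All (T ∘ p) ys → length ys ≤ 1
  atMostOne {[]}        _                _              = z≤n
  atMostOne {_ ∷ []}    _                _              = s≤s z≤n
  atMostOne {x ∷ y ∷ _} ((x≢y ∷ _) ∷ _) (px ∷ py ∷ _) = contradiction (solutionUnique x y px py) x≢y

VertexSet : ℕ → Set
VertexSet n = Fin n → Bool

_⊆_ : ∀ {n} → VertexSet n → VertexSet n → Set
S ⊆ S' = ∀ u → T (S u) → T (S' u)

size : ∀ {n} → VertexSet n → ℕ
size {n} S = count S (allFin n)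

size-bound : ∀ {n} (S : VertexSet n) → size S ≤ n
size-bound {n} S = ≤-trans (length-filter (T? ∘ S) (allFin n)) (≤-reflexive (length-tabulate {n = n} (λ u → u)))

-- An inflationary monotone operator F on vertex sets reaches an F-closed set
-- after n + 1 rounds: each round either is already closed or adds a vertex,
-- and a set of vertices has at most n elements.
module Stabilise {n : ℕ} (F : VertexSet n → VertexSet n)
                 (inflationary : ∀ S → S ⊆ F S)
                 (monotone : ∀ {S S'} → S ⊆ S' → F S ⊆ F S') where

  iterate : ℕ → VertexSet n → VertexSet n
  iterate zero    S = S
  iterate (suc k) S = F (iterate k S)

  Closed : VertexSet n → Set
  Closed S = F S ⊆ S

  iterate-inflationary : ∀ k S → S ⊆ iterate k S
  iterate-inflationary zero    S u Su = Su
  iterate-inflationary (suc k) S u Su = inflationary (iterate k S) u (iterate-inflationary k S u Su)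

  closed-or-grows : ∀ S → Closed S ⊎ size S < size (F S)
  closed-or-grows S with any? (λ u → T? (F S u) ×-dec ¬? (T? (S u)))
  ... | yes (u , FSu , ¬Su) = inj₂ (count-strict (inflationary S) (∈-allFin u) ¬Su FSu)
  ... | no noNewVertex     =
    inj₁ λ u FSu → decidable-stable (T? (S u)) (λ ¬Su → noNewVertex (u , FSu , ¬Su))

  -- Closedness persists, since F S ⊆ S gives F (F S) ⊆ F S by monotonicity;
  -- so after k rounds the set is closed or has at least k elements.
  closed-or-large : ∀ k S → Closed (iterate k S) ⊎ k ≤ size (iterate k S)
  closed-or-large zero    S = inj₂ z≤n
  closed-or-large (suc k) S with closed-or-large k S
  ... | inj₁ closed = inj₁ (monotone closed)
  ... | inj₂ large with closed-or-grows (iterate k S)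
  ...   | inj₁ closed = inj₁ (monotone closed)
  ...   | inj₂ grows  = inj₂ (≤-trans (s≤s large) grows)

  iterate-closed : ∀ S → Closed (iterate (suc n) S)
  iterate-closed S with closed-or-large (suc n) S
  ... | inj₁ closed = closed
  ... | inj₂ large  = contradiction (≤-trans large (size-bound (iterate (suc n) S))) 1+n≰n

module _ {n : ℕ} {G : Graph n} {H : Subgraph G} where

  _++ʷ_ : ∀ {a b c} → Walk H a b → Walk H b c → Walk H a c
  here _   ++ʷ W = W
  step e V ++ʷ W = step e (V ++ʷ W)

  walk-start : ∀ {a b} → Walk H a b → T (vs H a)
  walk-start (here a∈H)            = a∈H
  walk-start {a} (step {v = v} e _) = proj₁ (esVs H a v e)

  edge-flip : ∀ {u v} → T (es H u v) → T (es H v u)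
  edge-flip {u} {v} = subst T (esSym H u v)

  reverseʷ : ∀ {a b} → Walk H a b → Walk H b a
  reverseʷ (here a∈H)  = here a∈H
  reverseʷ (step e W) = reverseʷ W ++ʷ step (edge-flip e) (here (walk-start (step e W)))

-- The connected component of a vertex w in a subgraph H: the vertices
-- reachable from w, computed by stabilising "add all H-neighbours" from {w},
-- together with all H-edges between them.
module Component {n : ℕ} {G : Graph n} (H : Subgraph G) (w : Fin n) (w∈H : T (vs H w)) where

  addNeighbours : VertexSet n → VertexSet n
  addNeighbours S u = S u ∨ any (λ v → es H u v ∧ S v) (allFin n)

  addNeighbours-inflationary : ∀ S → S ⊆ addNeighbours S
  addNeighbours-inflationary S u Su = from T-∨ (inj₁ Su)

  addNeighbours-monotone : ∀ {S S'} → S ⊆ S' → addNeighbours S ⊆ addNeighbours S'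
  addNeighbours-monotone S⊆S' u grown with to T-∨ grown
  ... | inj₁ Su        = from T-∨ (inj₁ (S⊆S' u Su))
  ... | inj₂ neighbour =
    from T-∨ (inj₂ (any⁺ _ (Any.map (λ {v} → from T-∧ ∘ map₂ (S⊆S' v) ∘ to T-∧)
                                     (any⁻ _ (allFin n) neighbour))))

  open Stabilise addNeighbours addNeighbours-inflationary addNeighbours-monotone

  seed : VertexSet n
  seed u = ⌊ u ≟ w ⌋

  reach : VertexSet n
  reach = iterate (suc n) seed

  w∈reach : T (reach w)
  w∈reach = iterate-inflationary (suc n) seed w (fromWitness refl)

  reach-closed : ∀ {u v} → T (reach u) → T (es H u v) → T (reach v)
  reach-closed {u} {v} u∈ e =
    iterate-closed seed v (from T-∨ (inj₂ (any⁺ _ (lose (∈-allFin u) (from T-∧ (edge-flip {H = H} e , u∈))))))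

  walk-to-w : ∀ k u → T (iterate k seed u) → Walk H u w
  walk-to-w zero u u≡w with toWitness u≡w
  ... | refl = here w∈H
  walk-to-w (suc k) u added with to T-∨ added
  ... | inj₁ earlier   = walk-to-w k u earlier
  ... | inj₂ neighbour with satisfied (any⁻ _ (allFin n) neighbour)
  ...   | v , e∧earlier = step (proj₁ (to T-∧ e∧earlier)) (walk-to-w k v (proj₂ (to T-∧ e∧earlier)))

  component : Subgraph G
  component = record
    { vs    = reach
    ; es    = λ u v → es H u v ∧ (reach u ∧ reach v)
    ; esSym = λ u v → cong₂ _∧_ (esSym H u v) (∧-comm (reach u) (reach v))
    ; esAdj = λ u v e → esAdj H u v (proj₁ (to T-∧ e))
    ; esVs  = λ u v e → to (T-∧ {reach u}) (proj₂ (to (T-∧ {es H u v}) e))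
    }

  component⊆H : ∀ u → T (reach u) → T (vs H u)
  component⊆H u u∈ = walk-start (walk-to-w (suc n) u u∈)

  edge-in-component : ∀ {u v} → T (reach u) → T (es H u v) → T (es component u v)
  edge-in-component u∈ e = from T-∧ (e , from T-∧ (u∈ , reach-closed u∈ e))

  -- Reachability is closed under H-edges, so H-walks from the component stay in it.
  lift-walk : ∀ {a b} → T (reach a) → Walk H a b → Walk component a b
  lift-walk a∈ (here _)   = here a∈
  lift-walk a∈ (step e W) = step (edge-in-component a∈ e) (lift-walk (reach-closed a∈ e) W)

  component-connected : Connected component
  component-connected u v u∈ v∈ =
    lift-walk u∈ (walk-to-w (suc n) u u∈ ++ʷ reverseʷ (walk-to-w (suc n) v v∈))

  component-degree : ∀ u → T (reach u) → degIn H u ≤ degIn component u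
  component-degree u u∈ = count-mono (λ v → edge-in-component u∈) (allFin n)

withoutMatching : ∀ {n} {G : Graph n} (M : NewMatching G) → Subgraph (addEdges G M) → Subgraph G
withoutMatching {G = G} M H' = record
  { vs    = vs H'
  ; es    = λ u v → es H' u v ∧ adj G u v
  ; esSym = λ u v → cong₂ _∧_ (esSym H' u v) (Graph.sym G u v)
  ; esAdj = λ u v e → proj₂ (to T-∧ e)
  ; esVs  = λ u v e → esVs H' u v (proj₁ (to T-∧ e))
  }

-- Removing the matching costs each vertex at most one neighbour, because
-- every H'-edge is an edge of G or a matching edge, and a vertex lies on at
-- most one matching edge.
withoutMatching-degree : ∀ {n} {G : Graph n} (M : NewMatching G) (H' : Subgraph (addEdges G M)) u →
                         degIn H' u ≤ 1 + degIn (withoutMatching M H') u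
withoutMatching-degree {n} {G} M H' u = begin
  degIn H' u                                           ≤⟨ count-mono edge-split (allFin n) ⟩
  count (λ v → m M u v ∨ es H u v) (allFin n)          ≤⟨ count-∨ (m M u) (es H u) (allFin n) ⟩
  count (m M u) (allFin n) + degIn H u                 ≤⟨ +-monoˡ-≤ (degIn H u) matching-edges ⟩
  1 + degIn H u                                        ∎
  where
  open ≤-Reasoning
  H : Subgraph G
  H = withoutMatching M H'
  matching-edges : count (m M u) (allFin n) ≤ 1
  matching-edges = count-atMostOne (m M u) (Unique.allFin⁺ n) (mMatch M u)
  edge-split : ∀ v → T (es H' u v) → T (m M u v ∨ es H u v)
  edge-split v e with to T-∨ (esAdj H' u v e)
  ... | inj₁ inG       = from T-∨ (inj₂ (from T-∧ (e , inG)))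
  ... | inj₂ inMatching = from T-∨ (inj₁ inMatching)

-- A k-core of G + M through w yields a (k ∸ 1)-core of G through w: the
-- component of w after deleting the matching edges.
core-without-matching : ∀ {n} {G : Graph n} (M : NewMatching G) {k w} →
                        InCore (addEdges G M) k w → InCore G (k ∸ 1) w
core-without-matching M {k} (H' , (_ , deg') , w∈H') =
  component , (component-connected , degree) , w∈reach
  where
  open Component (withoutMatching M H') _ w∈H'
  open ≤-Reasoning
  degree : ∀ u → T (reach u) → k ∸ 1 ≤ degIn component u
  degree u u∈ = m≤n+o⇒m∸n≤o k 1 (begin
    k                                    ≤⟨ deg' u (component⊆H u u∈) ⟩
    degIn H' u                           ≤⟨ withoutMatching-degree M H' u ⟩
    1 + degIn (withoutMatching M H') u   ≤⟨ +-monoʳ-≤ 1 (component-degree u u∈) ⟩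
    1 + degIn component u                ∎)

lemma4 : ∀ {n} (G : Graph n) (M : NewMatching G) (w : Fin n) (c c' : ℕ)
         → IsCoreNumber G w c → IsCoreNumber (addEdges G M) w c'
         → c' ≤ c + 1
lemma4 G M w c c' (_ , maximal) (core' , _) = begin
  c'           ≤⟨ m≤n+m∸n c' 1 ⟩
  1 + (c' ∸ 1) ≤⟨ +-monoʳ-≤ 1 (maximal (c' ∸ 1) (core-without-matching M core')) ⟩
  1 + c        ≡⟨ +-comm 1 c ⟩
  c + 1        ∎
  where open ≤-Reasoning
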